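{- Let $G$ be a graph, $\mathcal{H}$ a family of connected subgraphs of $G$, and $(T,\mathcal{B})$ a tree decomposition of $G$ of width $t$ that is $k$-sparse with respect to $\mathcal{H}$. Then Algorithm $k$-SDS computes a dual support $Q^*$ for $(G,\mathcal{H})$ with $\mathrm{tw}(Q^*)\le k$.
   Context: A tree decomposition $(T,\mathcal{B})$ has bags $B_x\subseteq V(G)$, $x\in V(T)$, such that for each vertex the nodes whose bags contain it form a subtree and every edge lies in some bag. It is $k$-sparse with respect to $\mathcal{H}$ if every bag intersects at most $k$ members of $\mathcal{H}$. Algorithm $k$-SDS: for each node $x$ of $T$ form the bag $B'_x=\{H\in\mathcal{H}: V(H)\cap B_x\neq\emptyset\}$ and put a complete graph on $B'_x$; the resulting graph $Q^*$ on vertex set $\mathcal{H}$ (with tree decomposition $(T,\{B'_x\})$) is the output. A dual support for $(G,\mathcal{H})$ is a graph on $\mathcal{H}$ in which $\{H\in\mathcal{H}: v\in V(H)\}$ induces a connected subgraph for every $v\in V(G)$. -}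

module Defs where

open import Level using (0ℓ)
open import Data.Nat using (ℕ; zero; suc; _≤_)
open import Data.Fin using (Fin)
open import Data.Fin.Subset using (Subset; _∈_; _∩_; Nonempty; ∣_∣)
open import Data.Fin.Subset.Properties using (nonempty?)
open import Data.Vec using (tabulate)
open import Data.List using (List; _∷_; []; _++_; length)
open import Data.List.Relation.Unary.Linked using (Linked)
open import Data.List.Relation.Unary.Unique.Propositional using (Unique)
open import Data.Product using (Σ; ∃; _×_)
open import Relation.Nullary using (¬_; does)
open import Relation.Binary.PropositionalEquality using (_≡_; _≢_)

record Graph (n : ℕ) : Set₁ where
  field
    Adj    : Fin n → Fin n → Set
    sym    : ∀ {u v} → Adj u v → Adj v u
    irrefl : ∀ {u} → ¬ Adj u u
open Graph public

data Walk {n : ℕ} (R : Fin n → Fin n → Set) : Fin n → Fin n → Set where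
  here : ∀ {u} → Walk R u u
  step : ∀ {u v w} → R u v → Walk R v w → Walk R u w

Cycle : ∀ {n} → Graph n → Set
Cycle {n} G = Σ (Fin n) λ u → Σ (List (Fin n)) λ vs →
  (2 ≤ length vs) × Unique (u ∷ vs) × Linked (Adj G) (u ∷ vs ++ (u ∷ []))

record IsTree {p : ℕ} (T : Graph p) : Set where
  field
    nonempty  : 1 ≤ p
    connected : ∀ x y → Walk (Adj T) x y
    acyclic   : ¬ Cycle T

record Subgraph {n : ℕ} (G : Graph n) : Set₁ where
  field
    V      : Subset n
    E      : Fin n → Fin n → Set
    E-sym  : ∀ {u v} → E u v → E v u
    E-sub  : ∀ {u v} → E u v → u ∈ V × v ∈ V × Adj G u v
open Subgraph public

IsConnected : ∀ {n} {G : Graph n} → Subgraph G → Set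
IsConnected H = Nonempty (V H) × (∀ u v → u ∈ V H → v ∈ V H → Walk (E H) u v)

record IsTreeDecomposition {n p : ℕ} (G : Graph n) (T : Graph p)
                           (B : Fin p → Subset n) : Set where
  field
    tree      : IsTree T
    covers    : ∀ v → ∃ λ x → v ∈ B x
    edges     : ∀ u v → Adj G u v → ∃ λ x → u ∈ B x × v ∈ B x
    -- nodes whose bags contain v induce a connected subgraph (subtree) of T
    subtree   : ∀ v x y → v ∈ B x → v ∈ B y →
                Walk (λ a b → Adj T a b × v ∈ B a × v ∈ B b) x y

HasWidth : ∀ {n p} → (Fin p → Subset n) → ℕ → Set
HasWidth B t = (∀ x → ∣ B x ∣ ≤ suc t) × ∃ λ x → ∣ B x ∣ ≡ suc t

TreewidthAtMost : ∀ {n} → Graph n → ℕ → Set₁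
TreewidthAtMost {n} G k = Σ ℕ λ p → Σ (Graph p) λ T → Σ (Fin p → Subset n) λ B →
  IsTreeDecomposition G T B × (∀ x → ∣ B x ∣ ≤ suc k)

meeting : ∀ {n m} {G : Graph n} → (Fin m → Subgraph G) → Subset n → Subset m
meeting ℋ X = tabulate λ h → does (nonempty? (V (ℋ h) ∩ X))

IsSparse : ∀ {n m p} {G : Graph n} → ℕ → (Fin m → Subgraph G) →
           (Fin p → Subset n) → Set
IsSparse k ℋ B = ∀ x → ∣ meeting ℋ (B x) ∣ ≤ k

SDS-bags : ∀ {n m p} {G : Graph n} → (Fin m → Subgraph G) →
           (Fin p → Subset n) → Fin p → Subset m
SDS-bags ℋ B x = meeting ℋ (B x)

SDS : ∀ {n m p} {G : Graph n} → (Fin m → Subgraph G) →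
      (Fin p → Subset n) → Graph m
SDS {p = p} ℋ B = record
  { Adj    = λ h h' → h ≢ h' × ∃ λ (x : Fin p) → h ∈ SDS-bags ℋ B x × h' ∈ SDS-bags ℋ B x
  ; sym    = λ { (ne , x , a , b) → (λ e → ne (Eq.sym e)) , x , b , a }
  ; irrefl = λ { (ne , _) → ne Eq.refl }
  }
  where
    open import Data.Product using (_,_)
    import Relation.Binary.PropositionalEquality as Eq

IsDualSupport : ∀ {n m} {G : Graph n} → (Fin m → Subgraph G) → Graph m → Set
IsDualSupport ℋ Q = ∀ v h h' → v ∈ V (ℋ h) → v ∈ V (ℋ h') →
  Walk (λ a b → Adj Q a b × v ∈ V (ℋ a) × v ∈ V (ℋ b)) h h'

-- The bags of Q* containing H are the nodes whose bags meet V(H). For a single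
-- vertex these nodes form a subtree of T; along an edge of H the subtrees of its
-- ends share a node, so connectivity of H glues them into one subtree. Hence
-- (T, B') is a tree decomposition of Q*, of width at most k by sparsity. Members
-- of ℋ containing v all meet a bag holding v, so they are pairwise adjacent in Q*.
module Submission where

open import Defs
open import Data.Nat using (ℕ)
open import Data.Nat.Properties using (m≤n⇒m≤1+n)
open import Data.Fin using (Fin; _≟_)
open import Data.Fin.Subset using (Subset; _∈_; _∩_; Nonempty)
open import Data.Fin.Subset.Properties using (nonempty?; x∈p∩q⁺; x∈p∩q⁻)
open import Data.Vec.Properties using (lookup∘tabulate; lookup⇒[]=; []=⇒lookup)
open import Data.Bool using (true)
open import Data.Product using (_×_; _,_; proj₁; ∃)
open import Relation.Nullary using (yes; no; does; proof)
open import Relation.Nullary.Reflects using (Reflects; invert)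
open import Relation.Nullary.Decidable using (dec-true)
open import Relation.Binary.PropositionalEquality using (_≡_; refl; trans; subst) renaming (sym to ≡-sym)

_++ʷ_ : ∀ {k} {R : Fin k → Fin k → Set} {x y z} → Walk R x y → Walk R y z → Walk R x z
here     ++ʷ q = q
step r p ++ʷ q = step r (p ++ʷ q)

mapʷ : ∀ {k} {R S : Fin k → Fin k → Set} → (∀ {a b} → R a b → S a b) →
       ∀ {x y} → Walk R x y → Walk S x y
mapʷ f here       = here
mapʷ f (step r p) = step (f r) (mapʷ f p)

_restrictedTo_ : ∀ {k} → (Fin k → Fin k → Set) → (Fin k → Set) → Fin k → Fin k → Set
(R restrictedTo P) a b = R a b × P a × P b

restrictedTo-mono : ∀ {k} {R : Fin k → Fin k → Set} {P Q : Fin k → Set} →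
                    (∀ {a} → P a → Q a) →
                    ∀ {x y} → Walk (R restrictedTo P) x y → Walk (R restrictedTo Q) x y
restrictedTo-mono P⇒Q = mapʷ λ { (r , pa , pb) → r , P⇒Q pa , P⇒Q pb }

module _ {n m : ℕ} {G : Graph n} (ℋ : Fin m → Subgraph G) {h : Fin m} {X : Subset n} where

  ∈-meeting⁺ : Nonempty (V (ℋ h) ∩ X) → h ∈ meeting ℋ X
  ∈-meeting⁺ ne = lookup⇒[]= h (meeting ℋ X)
    (trans (lookup∘tabulate _ h) (dec-true (nonempty? (V (ℋ h) ∩ X)) ne))

  ∈-meeting⁻ : h ∈ meeting ℋ X → Nonempty (V (ℋ h) ∩ X)
  ∈-meeting⁻ mem = invert (subst (Reflects _) does≡true (proof (nonempty? (V (ℋ h) ∩ X))))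
    where
    does≡true : does (nonempty? (V (ℋ h) ∩ X)) ≡ true
    does≡true = trans (≡-sym (lookup∘tabulate _ h)) ([]=⇒lookup mem)

module _ {n p : ℕ} {G : Graph n} {T : Graph p} {B : Fin p → Subset n}
         (td : IsTreeDecomposition G T B) (H : Subgraph G) where

  open IsTreeDecomposition td

  MeetsBag : Fin p → Set
  MeetsBag x = Nonempty (V H ∩ B x)

  walk⇒bag-walk : ∀ {u w x y} → u ∈ V H → Walk (E H) u w → u ∈ B x → w ∈ B y →
                  Walk (Adj T restrictedTo MeetsBag) x y
  walk⇒bag-walk {u} {x = x} {y} u∈H here u∈x u∈y =
    restrictedTo-mono (λ u∈a → u , x∈p∩q⁺ (u∈H , u∈a)) (subtree u x y u∈x u∈y)
  walk⇒bag-walk u∈H (step e rest) u∈x w∈y with E-sub H e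
  ... | _ , u′∈H , adj with edges _ _ adj
  ... | z , u∈z , u′∈z = walk⇒bag-walk u∈H here u∈x u∈z ++ʷ walk⇒bag-walk u′∈H rest u′∈z w∈y

  bags-meeting-connected : IsConnected H → ∀ x y → MeetsBag x → MeetsBag y →
                           Walk (Adj T restrictedTo MeetsBag) x y
  bags-meeting-connected (_ , walk) x y (u , u∈H∩x) (w , w∈H∩y) =
    let u∈H , u∈x = x∈p∩q⁻ (V H) (B x) u∈H∩x
        w∈H , w∈y = x∈p∩q⁻ (V H) (B y) w∈H∩y
    in walk⇒bag-walk u∈H (walk u w u∈H w∈H) u∈x w∈y

module _ {n m p : ℕ} {G : Graph n} (ℋ : Fin m → Subgraph G) {B : Fin p → Subset n} where

  SDS-isDualSupport : (∀ v → ∃ λ x → v ∈ B x) → IsDualSupport ℋ (SDS ℋ B)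
  SDS-isDualSupport covers v h h′ v∈h v∈h′ with h ≟ h′ | covers v
  ... | yes refl | _       = here
  ... | no h≢h′  | x , v∈x =
    step ((h≢h′ , x , ∈-meeting⁺ ℋ (v , x∈p∩q⁺ (v∈h , v∈x))
                    , ∈-meeting⁺ ℋ (v , x∈p∩q⁺ (v∈h′ , v∈x))) , v∈h , v∈h′) here

  SDS-isTreeDecomposition : {T : Graph p} → (∀ h → IsConnected (ℋ h)) →
                            IsTreeDecomposition G T B →
                            IsTreeDecomposition (SDS ℋ B) T (SDS-bags ℋ B)
  SDS-isTreeDecomposition connected td = record
    { tree    = tree
    ; covers  = λ h → let u , u∈h = proj₁ (connected h) ; x , u∈x = covers u
                      in x , ∈-meeting⁺ ℋ (u , x∈p∩q⁺ (u∈h , u∈x))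
    ; edges   = λ { h h′ (_ , x , h∈x , h′∈x) → x , h∈x , h′∈x }
    ; subtree = λ h x y h∈x h∈y →
        restrictedTo-mono (∈-meeting⁺ ℋ)
          (bags-meeting-connected td (ℋ h) (connected h) x y (∈-meeting⁻ ℋ h∈x) (∈-meeting⁻ ℋ h∈y))
    }
    where
    open IsTreeDecomposition td

lemma6 : ∀ {n m p : ℕ} (G : Graph n) (ℋ : Fin m → Subgraph G)
         (T : Graph p) (B : Fin p → Subset n) (t k : ℕ) →
         (∀ h → IsConnected (ℋ h)) →
         IsTreeDecomposition G T B → HasWidth B t → IsSparse k ℋ B →
         IsDualSupport ℋ (SDS ℋ B) × TreewidthAtMost (SDS ℋ B) k
lemma6 {p = p} G ℋ T B t k connected td _ sparse =
  SDS-isDualSupport ℋ (IsTreeDecomposition.covers td) ,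
  (p , T , SDS-bags ℋ B , SDS-isTreeDecomposition ℋ connected td , λ x → m≤n⇒m≤1+n (sparse x))
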